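{- Let $\mathcal G=(V,V_0,V_1,T,E)$ be a finite acyclic game graph and $\sigma\in\{0,1\}$. Let $P$ be any of the provenance semirings $\mathbb N[T]$, $\mathbb B[T]$, $\mathbb W[T]$, $\mathbb S[T]$, $\mathsf{PosBool}(T)$, and let $f_\sigma:V\to P$ be the valuation for Player $\sigma$ induced by $f_\sigma(t)=t$ for $t\in T$ and $h_\sigma\equiv1$. For $W\subseteq T$, write $f_\sigma(v)=f^W_\sigma(v)+g^W_\sigma(v)$, where $f^W_\sigma(v)$ is the sum of those monomials of $f_\sigma(v)$ containing only indeterminates from $W$ and $g^W_\sigma(v)$ is the sum of the remaining monomials. Then for every $W\subseteq T$ and every $v\in V$, Player $\sigma$ has a strategy from $v$ to reach $W$ if and only if $f^W_\sigma(v)\neq0$. Moreover, if one sets $f_\sigma(t)=1$ for $t\in W$ and $f_\sigma(t)=0$ for $t\in T\setminus W$ (and $h_\sigma\equiv 1$) and evaluates in the semiring $\mathbb N$ of natural numbers, then $f_\sigma(v)$ is the number of distinct strategies of Player $\sigma$ from $v$ that reach $W$.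
   Context: A game graph is $\mathcal G=(V,V_0,V_1,T,E)$ where $V$ is the disjoint union of $V_0$ (positions of Player 0), $V_1$ (positions of Player 1) and $T$ (terminal positions), $E\subseteq V\times V$, $vE=\{w:(v,w)\in E\}$, $vE=\emptyset$ iff $v\in T$. For a semiring $K$ and $f_\sigma:T\to K$, the valuation $f_\sigma:V\to K$ (with all move values $1$) is defined by backward induction: $f_\sigma(v)=\sum_{w\in vE}f_\sigma(w)$ if $v\in V_\sigma$ and $f_\sigma(v)=\prod_{w\in vE}f_\sigma(w)$ if $v\in V_{1-\sigma}$. A strategy of Player $\sigma$ from $v$ is a subtree of the tree unraveling from $v$ (tree of all finite paths from $v$), containing the root and closed under prefixes, keeping exactly one successor at nodes ending in $V_\sigma$ and all successors at nodes ending in $V_{1-\sigma}$; it reaches $W$ if every play consistent with it (maximal root path) ends in a position of $W$. Semirings: $\mathbb N[T]$ = polynomials with coefficients in $\mathbb N$ in indeterminates $T$; $\mathbb B[T]$ = polynomials with Boolean coefficients (finite sets of monomials, idempotent addition), the free $+$-idempotent semiring on $T$; $\mathbb W[T]$ = obtained from $\mathbb B[T]$ by dropping exponents (finite sums of monomials linear in each indeterminate); $\mathbb S[T]$ = the free absorptive semiring ($a+ab=a$), whose non-trivial elements are antichains of monomials under the order by componentwise comparison of exponents, the quotient of $\mathbb N[T]$ by $p\sim q$ whenever $p=qr$ for monomials; $\mathsf{PosBool}(T)$ = positive Boolean expressions in variables $T$ up to equivalence (the free distributive lattice on $T$, elements written in irredundant disjunctive normal form, with monomials the conjunctions), with $+=\vee$,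 $\cdot=\wedge$. -}

module Defs where

open import Data.Nat using (ℕ; zero; suc; _+_; _*_; _⊓_; _≤ᵇ_; _≡ᵇ_)
open import Data.Bool using (Bool; true; false; _∧_; not; if_then_else_; T)
open import Data.Fin using (Fin)
open import Data.Fin.Subset using (Subset; _∈_)
open import Data.Vec using (Vec; []; _∷_; replicate; zipWith; lookup; _[_]≔_)
import Data.Vec as Vec
open import Data.Vec.Properties using (≡-dec)
import Data.Nat.Properties as ℕP
open import Data.List using (List; []; _∷_; _++_; map; foldr; filterᵇ; deduplicate; null; concatMap)
open import Data.Bool.ListAction using (any)
open import Data.Unit using (⊤)
open import Data.Product using (_×_)
open import Data.List.Relation.Unary.Any using (Any)
open import Data.List.Relation.Unary.All using (All; []; _∷_)
open import Data.List.Relation.Unary.Unique.Propositional using (Unique)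
open import Data.List.Relation.Binary.Permutation.Propositional using (_↭_)
open import Data.List.Membership.Propositional renaming (_∈_ to _∈ₗ_)
open import Relation.Binary.PropositionalEquality using (_≡_)
open import Relation.Nullary using (¬_)

data Player : Set where
  P0 P1 : Player

_==ᴾ_ : Player → Player → Bool
P0 ==ᴾ P0 = true
P1 ==ᴾ P1 = true
_  ==ᴾ _  = false

opp : Player → Player
opp P0 = P1
opp P1 = P0

-- Finite game graphs with positions Fin n.
-- vE = succ v (a duplicate-free list, since E is a set of edges).
-- T = {v | vE = ∅}; a non-terminal v is in V_σ iff owner v ≡ σ
-- (the value of owner on terminal positions is irrelevant).

record GameGraph (n : ℕ) : Set where
  field
    succ        : Fin n → List (Fin n)
    owner       : Fin n → Player
    succ-unique : ∀ v → Unique (succ v)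

module _ {n : ℕ} (G : GameGraph n) where
  open GameGraph G

  Terminal : Fin n → Set
  Terminal v = succ v ≡ []

  data Path : Fin n → Fin n → Set where
    edge : ∀ {v w} → w ∈ₗ succ v → Path v w
    step : ∀ {v w u} → w ∈ₗ succ v → Path w u → Path v u

  Acyclic : Set
  Acyclic = ∀ v → ¬ Path v v

  -- Backward-induction valuation over a (raw) semiring (A, +, ·, 0, 1)
  -- with all move values 1, given on terminals by leaf.
  -- Defined by unfolding with fuel; in an acyclic graph with n
  -- positions every path has < n edges, so fuel n computes the
  -- backward induction exactly (the fuel-0 case is never reached).

  valuationFuel : {A : Set} → (A → A → A) → (A → A → A) → A → A →
                  (Fin n → A) → Player → ℕ → Fin n → A
  valuationFuel _⊕_ _⊗_ 𝟘 𝟙 leaf σ zero v = 𝟘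
  valuationFuel _⊕_ _⊗_ 𝟘 𝟙 leaf σ (suc k) v with succ v
  ... | []     = leaf v
  ... | w ∷ ws =
    let vals = map (valuationFuel _⊕_ _⊗_ 𝟘 𝟙 leaf σ k) (w ∷ ws) in
    if owner v ==ᴾ σ then foldr _⊕_ 𝟘 vals else foldr _⊗_ 𝟙 vals

  valuation : {A : Set} → (A → A → A) → (A → A → A) → A → A →
              (Fin n → A) → Player → Fin n → A
  valuation _⊕_ _⊗_ 𝟘 𝟙 leaf σ = valuationFuel _⊕_ _⊗_ 𝟘 𝟙 leaf σ n

  -- Strategies of Player σ from v: the subtrees of the tree unraveling,
  -- represented inductively (finite, since all plays are finite).
  --   terminal node: a leaf;
  --   node of Player σ: exactly one successor kept (Any = a position
  --     in the duplicate-free list succ v, with a substrategy);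
  --   node of Player 1-σ: all successors kept (All).

  data Strategy (σ : Player) : Fin n → Set where
    leaf : ∀ {v} → T (null (succ v)) → Strategy σ v
    move : ∀ {v} → owner v ≡ σ → Any (Strategy σ) (succ v) → Strategy σ v
    all  : ∀ {v} → owner v ≡ opp σ → T (not (null (succ v))) →
           All (Strategy σ) (succ v) → Strategy σ v

  mutual
    Reaches : ∀ {σ} (W : Subset n) {v} → Strategy σ v → Set
    Reaches W {v} (leaf _)     = v ∈ W
    Reaches W     (move _ s)   = ReachesAny W s
    Reaches W     (all _ _ ss) = ReachesAll W ss

    ReachesAny : ∀ {σ} (W : Subset n) {ws} → Any (Strategy σ) ws → Set
    ReachesAny W (Any.here s)  = Reaches W s
    ReachesAny W (Any.there s) = ReachesAny W s

    ReachesAll : ∀ {σ} (W : Subset n) {ws} → All (Strategy σ) ws → Set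
    ReachesAll W []       = ⊤
    ReachesAll W (s ∷ ss) = Reaches W s × ReachesAll W ss

-- A monomial over the indeterminates T ⊆ Fin n is an exponent vector
-- Vec ℕ n (only terminal positions occur).  A polynomial of ℕ[T] is a
-- formal sum of monomials, i.e. a list of monomials taken up to
-- permutation (multiplicity of a monomial = its coefficient).

Monomial : ℕ → Set
Monomial n = Vec ℕ n

Poly : ℕ → Set
Poly n = List (Monomial n)

module _ {n : ℕ} where

  mon1 : Monomial n
  mon1 = replicate n 0

  var : Fin n → Monomial n
  var t = replicate n 0 [ t ]≔ 1

  _·ₘ_ : Monomial n → Monomial n → Monomial n
  _·ₘ_ = zipWith _+_

  _+ₚ_ : Poly n → Poly n → Poly n
  _+ₚ_ = _++_

  _·ₚ_ : Poly n → Poly n → Poly n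
  p ·ₚ q = concatMap (λ m → map (m ·ₘ_) q) p

  0ₚ 1ₚ : Poly n
  0ₚ = []
  1ₚ = mon1 ∷ []

  dropExp : Monomial n → Monomial n
  dropExp = Vec.map (_⊓ 1)

  _≤ₘ_ : Monomial n → Monomial n → Bool
  m ≤ₘ m' = Vec.foldr (λ _ → Bool) _∧_ true (zipWith _≤ᵇ_ m m')

  _==ₘ_ : Monomial n → Monomial n → Bool
  m ==ₘ m' = Vec.foldr (λ _ → Bool) _∧_ true (zipWith _≡ᵇ_ m m')

  _<ₘ_ : Monomial n → Monomial n → Bool
  m <ₘ m' = (m ≤ₘ m') ∧ not (m ==ₘ m')

  dedup : Poly n → Poly n
  dedup = deduplicate (≡-dec ℕP._≟_)

  -- minimal monomials (absorption a + a·b = a), as an antichain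
  minimal : Poly n → Poly n
  minimal p = dedup (filterᵇ (λ m → not (any (λ m' → m' <ₘ m) p)) p)

data ProvSemiring : Set where
  ℕ[T] 𝔹[T] 𝕎[T] 𝕊[T] PosBool[T] : ProvSemiring

-- canonical form of the image of an ℕ[T]-polynomial in each semiring
-- (each is a quotient of ℕ[T] by a semiring congruence):
--   ℕ[T]: the multiset of monomials itself
--   𝔹[T]: the set of monomials (idempotent +)
--   𝕎[T]: the set of exponent-dropped monomials
--   𝕊[T]: the antichain of minimal monomials (componentwise order)
--   PosBool(T): irredundant DNF = antichain of minimal conjunctions
normal : ∀ {n} → ProvSemiring → Poly n → Poly n
normal ℕ[T]       p = p
normal 𝔹[T]       p = dedup p
normal 𝕎[T]       p = dedup (map dropExp p)
normal 𝕊[T]       p = minimal p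
normal PosBool[T] p = minimal (map dropExp p)

_≈[_]_ : ∀ {n} → Poly n → ProvSemiring → Poly n → Set
p ≈[ P ] q = normal P p ↭ normal P q

module _ {n : ℕ} (G : GameGraph n) where

  -- f_σ : V → P induced by f_σ(t) = t (computed in ℕ[T]; its element
  -- of P is its image under `normal P`)
  fval : Player → Fin n → Poly n
  fval σ = valuation G _+ₚ_ _·ₚ_ 0ₚ 1ₚ (λ t → var t ∷ []) σ

  onlyIn : Subset n → Monomial n → Bool
  onlyIn W m = Vec.foldr (λ _ → Bool) _∧_ true
                 (zipWith (λ b e → if b then true else (e ≡ᵇ 0)) W m)

  fW : ProvSemiring → Player → Subset n → Fin n → Poly n
  fW P σ W v = filterᵇ (onlyIn W) (normal P (fval σ v))

  countVal : Player → Subset n → Fin n → ℕ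
  countVal σ W = valuation G _+_ _*_ 0 1
                   (λ t → if lookup W t then 1 else 0) σ

-- Read an element of the valuation semiring as a type of witnesses: a natural number k as Fin k,
-- a polynomial as the occurrences of its monomials that use only indeterminates from W.  Both
-- readings send + to ⊎, · to ×, 0 to ⊥ and 1 to ⊤, and strategies of Player σ unfold in exactly
-- the same way: a strategy reaching W from a position of σ is one successor together with such a
-- strategy there, from an opponent position a tuple of such strategies for all successors, and a
-- terminal t admits one iff t ∈ W.  Backward induction, which terminates because the game is
-- finite and acyclic, therefore yields bijections between the strategies reaching W and Fin f(v)
-- for the 0/1 valuation in ℕ, respectively the W-monomials of f(v) in ℕ[T].  The other provenance
-- semirings are quotients of ℕ[T] whose normal forms (removing duplicates, dropping exponents,
-- keeping minimal monomials) keep some W-monomial as long as there was one, because every monomial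
-- dividing a W-monomial is again a W-monomial.

module Submission where

open import Defs
open import Algebra.Bundles using (CommutativeMonoid)
open import Axiom.UniquenessOfIdentityProofs.WithK using (uip)
open import Data.Bool using (Bool; true; false; T; not; _∧_; if_then_else_)
open import Data.Bool.ListAction using (any)
open import Data.Bool.Properties using (T-∧; T-irrelevant; ∧-commutativeMonoid)
open import Data.Empty using (⊥; ⊥-elim)
open import Data.Fin using (Fin; zero; suc)
open import Data.Fin.Properties using (0↔⊥; 1↔⊤; +↔⊎; *↔×)
open import Data.Fin.Subset using (Subset; _∈_; _∉_; _∪_; ⁅_⁆; ∣_∣)
  renaming (⊥ to ∅)
open import Data.Fin.Subset.Properties
  using (∉⊥; ∈⊤; x∈⁅x⁆; x∈⁅y⁆⇒x≡y; x∈p∪q⁻; x∈p∪q⁺; p⊆p∪q; p⊂q⇒∣p∣<∣q∣; ∣p∣≤n; ∣p∣≡n⇒p≡⊤)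
open import Data.List using (List; []; _∷_; null; map; foldr; filterᵇ; concatMap)
open import Data.List.Membership.Propositional using (find; lose) renaming (_∈_ to _∈ₗ_)
open import Data.List.Membership.Propositional.Properties using (∈-filter⁺)
open import Data.List.Properties using (filter-none)
open import Data.List.Relation.Binary.Permutation.Propositional using (↭-reflexive)
open import Data.List.Relation.Binary.Permutation.Propositional.Properties using (Any-resp-↭)
open import Data.List.Relation.Unary.All as All using (All; []; _∷_)
open import Data.List.Relation.Unary.All.Properties using (¬Any⇒All¬)
open import Data.List.Relation.Unary.Any as Any using (Any; here; there; any?)
open import Data.List.Relation.Unary.Any.Properties
  using (Any-cong; ¬Any[]; ⊥↔Any[]; ++↔; concat↔; map↔; map⁺; map⁻; ×↔; pure↔; any⁻;
         filter⁻; deduplicate⁺; deduplicate⁻)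
open import Data.Nat using (ℕ; zero; suc; _+_; _*_; _≤_; _<_; _≡ᵇ_; z≤n)
open import Data.Nat.Induction using (<-wellFounded)
open import Data.Nat.Properties
  using (_≟_; ≤ᵇ⇒≤; ≡⇒≡ᵇ; ≤∧≢⇒<; ≤-antisym; m≤m+n; +-suc; +-mono-≤; +-mono-<-≤; +-monoʳ-<;
         +-monoʳ-≤; module ≤-Reasoning)
open import Data.Product using (Σ; _×_; _,_; proj₁; proj₂)
open import Data.Product.Function.NonDependent.Propositional using (_×-cong_)
open import Data.Sum using (_⊎_; inj₁; inj₂)
open import Data.Sum.Function.Propositional using (_⊎-cong_)
open import Data.Unit using (⊤; tt)
open import Data.Vec using ([]; _∷_; lookup; zipWith)
import Data.Vec as Vec
open import Data.Vec.Properties using (≡-dec; []=↔lookup)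
open import Function using (_∘_)
open import Function.Bundles using (_⇔_; _↔_; mk⇔; mk↔ₛ′; Equivalence)
open import Function.Properties.Equivalence using () renaming (sym to ⇔-sym; trans to ⇔-trans; refl to ⇔-refl)
open import Function.Properties.Inverse using (↔-refl; ↔-sym; ↔-trans; ↔⇒⇔)
open import Function.Related.Propositional using (bijection; ≡⇒; module EquationalReasoning)
open import Induction.WellFounded using (WellFounded; Acc; acc; module Subrelation)
import Relation.Binary.Construct.On as On
open import Relation.Binary.PropositionalEquality using (_≡_; refl; cong; sym; trans; subst)
open import Relation.Nullary using (¬_; yes; no; contradiction)
open import Relation.Nullary.Decidable using (T?)
open import Algebra.Properties.CommutativeSemigroup
  (CommutativeMonoid.commutativeSemigroup ∧-commutativeMonoid) using (interchange)

T⇒¬T-not : ∀ {b} → T b → ¬ T (not b)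
T⇒¬T-not {true} _ ()

¬T⇒T-not : ∀ {b} → ¬ T b → T (not b)
¬T⇒T-not {false} _  = tt
¬T⇒T-not {true}  ¬t = ¬t tt

T↔≡true : ∀ {b} → T b ↔ (b ≡ true)
T↔≡true {true}  = mk↔ₛ′ (λ _ → refl) (λ _ → tt) (λ { refl → refl }) (λ _ → refl)
T↔≡true {false} = mk↔ₛ′ (λ ()) (λ ()) (λ ()) (λ ())

T-∧↔ : ∀ {a b} → T (a ∧ b) ↔ (T a × T b)
T-∧↔ {true}  = mk↔ₛ′ (tt ,_) proj₂ (λ _ → refl) (λ _ → refl)
T-∧↔ {false} = mk↔ₛ′ (λ ()) proj₁ (λ { (() , _) }) (λ ())

null⇒¬Any : ∀ {A : Set} {P : A → Set} {xs} → T (null xs) → ¬ Any P xs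
null⇒¬Any {xs = []} _ ()

null⊎nonNull : ∀ {A : Set} (xs : List A) → T (null xs) ⊎ T (not (null xs))
null⊎nonNull []      = inj₁ tt
null⊎nonNull (_ ∷ _) = inj₂ tt

≢opp : ∀ σ → σ ≡ opp σ → ⊥
≢opp P0 ()
≢opp P1 ()

≡⊎≡opp : ∀ τ σ → τ ≡ σ ⊎ τ ≡ opp σ
≡⊎≡opp P0 P0 = inj₁ refl
≡⊎≡opp P0 P1 = inj₂ refl
≡⊎≡opp P1 P0 = inj₂ refl
≡⊎≡opp P1 P1 = inj₁ refl

==ᴾ-refl : ∀ σ → (σ ==ᴾ σ) ≡ true
==ᴾ-refl P0 = refl
==ᴾ-refl P1 = refl

==ᴾ-opp : ∀ σ → (opp σ ==ᴾ σ) ≡ false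
==ᴾ-opp P0 = refl
==ᴾ-opp P1 = refl

record TypeInterpretation {A : Set} (_⊕_ _⊗_ : A → A → A) (𝟘 𝟙 : A) : Set₁ where
  field
    ⟦_⟧ : A → Set
    ⟦⊕⟧ : ∀ a b → ⟦ a ⊕ b ⟧ ↔ (⟦ a ⟧ ⊎ ⟦ b ⟧)
    ⟦⊗⟧ : ∀ a b → ⟦ a ⊗ b ⟧ ↔ (⟦ a ⟧ × ⟦ b ⟧)
    ⟦𝟘⟧ : ⟦ 𝟘 ⟧ ↔ ⊥
    ⟦𝟙⟧ : ⟦ 𝟙 ⟧ ↔ ⊤

-- Strategies and backward induction

module _ {n : ℕ} (G : GameGraph n) where
  open GameGraph G

  DepthBelow : ℕ → Fin n → Set
  DepthBelow zero    v = ⊥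
  DepthBelow (suc k) v = All (DepthBelow k) (succ v)

  Path-snoc : ∀ {u v w} → Path G u v → w ∈ₗ succ v → Path G u w
  Path-snoc (edge e)   e′ = step e (edge e′)
  Path-snoc (step e p) e′ = step e (Path-snoc p e′)

  -- p holds the positions of the path walked so far into v; each step adds one, so at most n
  -- steps can be taken.
  depthBelow-avoiding : Acyclic G → ∀ k (p : Subset n) v → v ∉ p →
                        (∀ {u} → u ∈ p → Path G u v) → n ≤ k + ∣ p ∣ → DepthBelow k v
  depthBelow-avoiding acyclic zero p v v∉p _ n≤∣p∣ =
    v∉p (subst (v ∈_) (sym (∣p∣≡n⇒p≡⊤ (≤-antisym (∣p∣≤n p) n≤∣p∣))) ∈⊤)
  depthBelow-avoiding acyclic (suc k) p v v∉p reach n≤ =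
    All.tabulate λ e → depthBelow-avoiding acyclic k p′ _ (fresh e) (reach′ e) bound
    where
      p′ = p ∪ ⁅ v ⁆
      fresh : ∀ {w} → w ∈ₗ succ v → w ∉ p′
      fresh e w∈p′ with x∈p∪q⁻ p ⁅ v ⁆ w∈p′
      ... | inj₁ w∈p = acyclic _ (Path-snoc (reach w∈p) e)
      ... | inj₂ w∈v with refl ← x∈⁅y⁆⇒x≡y v w∈v = acyclic v (edge e)
      reach′ : ∀ {w} → w ∈ₗ succ v → ∀ {u} → u ∈ p′ → Path G u w
      reach′ e u∈p′ with x∈p∪q⁻ p ⁅ v ⁆ u∈p′
      ... | inj₁ u∈p = Path-snoc (reach u∈p) e
      ... | inj₂ u∈v with refl ← x∈⁅y⁆⇒x≡y v u∈v = edge e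
      bound : n ≤ k + ∣ p′ ∣
      bound = begin
        n                ≤⟨ n≤ ⟩
        suc (k + ∣ p ∣)  ≡⟨ +-suc k ∣ p ∣ ⟨
        k + suc ∣ p ∣    ≤⟨ +-monoʳ-≤ k (p⊂q⇒∣p∣<∣q∣ p⊂p′) ⟩
        k + ∣ p′ ∣       ∎
        where
          open ≤-Reasoning
          p⊂p′ = (λ {x} → p⊆p∪q {p = p} ⁅ v ⁆ {x}) , v , x∈p∪q⁺ (inj₂ (x∈⁅x⁆ v)) , v∉p

  acyclic⇒depthBelow : Acyclic G → ∀ v → DepthBelow n v
  acyclic⇒depthBelow acyclic v =
    depthBelow-avoiding acyclic n ∅ v ∉⊥ (λ u∈∅ → contradiction u∈∅ ∉⊥) (m≤m+n n ∣ ∅ {n} ∣)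

  module _ (σ : Player) where

    data PositionView (v : Fin n) : Set where
      terminal : T (null (succ v)) → PositionView v
      own      : owner v ≡ σ → T (not (null (succ v))) → PositionView v
      opponent : owner v ≡ opp σ → T (not (null (succ v))) → PositionView v

    positionView : ∀ v → PositionView v
    positionView v with null⊎nonNull (succ v) | ≡⊎≡opp (owner v) σ
    ... | inj₁ t  | _         = terminal t
    ... | inj₂ nt | inj₁ mine = own mine nt
    ... | inj₂ nt | inj₂ opp′ = opponent opp′ nt

    module _ {A : Set} (_⊕_ _⊗_ : A → A → A) (𝟘 𝟙 : A) (leaf : Fin n → A) where
      private
        val : ℕ → Fin n → A
        val = valuationFuel G _⊕_ _⊗_ 𝟘 𝟙 leaf σ

      valuationFuel-terminal : ∀ k {v} → T (null (succ v)) → val (suc k) v ≡ leaf v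
      valuationFuel-terminal k {v} t with succ v
      ... | [] = refl

      valuationFuel-own : ∀ k {v} → owner v ≡ σ → T (not (null (succ v))) →
                          val (suc k) v ≡ foldr _⊕_ 𝟘 (map (val k) (succ v))
      valuationFuel-own k {v} mine nt with succ v
      ... | _ ∷ _ rewrite mine | ==ᴾ-refl σ = refl

      valuationFuel-opponent : ∀ k {v} → owner v ≡ opp σ → T (not (null (succ v))) →
                               val (suc k) v ≡ foldr _⊗_ 𝟙 (map (val k) (succ v))
      valuationFuel-opponent k {v} theirs nt with succ v
      ... | _ ∷ _ rewrite theirs | ==ᴾ-opp σ = refl

    module _ (W : Subset n) where

      ReachingStrategy : Fin n → Set
      ReachingStrategy v = Σ (Strategy G σ v) (Reaches G W)

      ReachingChoice : List (Fin n) → Set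
      ReachingChoice ws = Σ (Any (Strategy G σ) ws) (ReachesAny G W)

      ReachingAll : List (Fin n) → Set
      ReachingAll ws = Σ (All (Strategy G σ) ws) (ReachesAll G W)

      reachingChoice-[] : ReachingChoice [] ↔ ⊥
      reachingChoice-[] = mk↔ₛ′ (λ { (() , _) }) (λ ()) (λ ()) (λ { (() , _) })

      reachingChoice-∷ : ∀ {w ws} → ReachingChoice (w ∷ ws) ↔ (ReachingStrategy w ⊎ ReachingChoice ws)
      reachingChoice-∷ = mk↔ₛ′ to from (λ { (inj₁ _) → refl ; (inj₂ _) → refl })
                                      (λ { (here _ , _) → refl ; (there _ , _) → refl })
        where
          to : ∀ {w ws} → ReachingChoice (w ∷ ws) → ReachingStrategy w ⊎ ReachingChoice ws
          to (here s  , r) = inj₁ (s , r)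
          to (there c , r) = inj₂ (c , r)
          from : ∀ {w ws} → ReachingStrategy w ⊎ ReachingChoice ws → ReachingChoice (w ∷ ws)
          from (inj₁ (s , r)) = here s , r
          from (inj₂ (c , r)) = there c , r

      reachingAll-[] : ReachingAll [] ↔ ⊤
      reachingAll-[] = mk↔ₛ′ (λ _ → tt) (λ _ → [] , tt) (λ _ → refl) (λ { ([] , tt) → refl })

      reachingAll-∷ : ∀ {w ws} → ReachingAll (w ∷ ws) ↔ (ReachingStrategy w × ReachingAll ws)
      reachingAll-∷ = mk↔ₛ′ (λ { (s ∷ ss , r , rs) → (s , r) , (ss , rs) })
                            (λ { ((s , r) , (ss , rs)) → s ∷ ss , r , rs })
                            (λ _ → refl) (λ { (_ ∷ _ , _) → refl })

      reachingStrategy-terminal : ∀ {v} → T (null (succ v)) → ReachingStrategy v ↔ v ∈ W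
      reachingStrategy-terminal {v} t = mk↔ₛ′ to (leaf t ,_) (λ _ → refl) from∘to
        where
          to : ReachingStrategy v → v ∈ W
          to (leaf _ , r)     = r
          to (move _ c , _)   = ⊥-elim (null⇒¬Any t c)
          to (all _ nt _ , _) = ⊥-elim (T⇒¬T-not t nt)
          from∘to : ∀ s → (leaf t , to s) ≡ s
          from∘to (leaf t′ , r) with refl ← T-irrelevant t t′ = refl
          from∘to (move _ c , _)   = ⊥-elim (null⇒¬Any t c)
          from∘to (all _ nt _ , _) = ⊥-elim (T⇒¬T-not t nt)

      reachingStrategy-own : ∀ {v} → owner v ≡ σ → T (not (null (succ v))) →
                             ReachingStrategy v ↔ ReachingChoice (succ v)
      reachingStrategy-own {v} mine nt = mk↔ₛ′ to (λ (c , r) → move mine c , r) (λ _ → refl) from∘to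
        where
          to : ReachingStrategy v → ReachingChoice (succ v)
          to (leaf t , _)         = ⊥-elim (T⇒¬T-not t nt)
          to (move _ c , r)       = c , r
          to (all theirs _ _ , _) = ⊥-elim (≢opp σ (trans (sym mine) theirs))
          from∘to : ∀ s → (move mine (proj₁ (to s)) , proj₂ (to s)) ≡ s
          from∘to (leaf t , _)          = ⊥-elim (T⇒¬T-not t nt)
          from∘to (move mine′ c , r) with refl ← uip mine mine′ = refl
          from∘to (all theirs _ _ , _)  = ⊥-elim (≢opp σ (trans (sym mine) theirs))

      reachingStrategy-opponent : ∀ {v} → owner v ≡ opp σ → T (not (null (succ v))) →
                                  ReachingStrategy v ↔ ReachingAll (succ v)
      reachingStrategy-opponent {v} theirs nt = mk↔ₛ′ to (λ (a , r) → all theirs nt a , r) (λ _ → refl) from∘to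
        where
          to : ReachingStrategy v → ReachingAll (succ v)
          to (leaf t , _)      = ⊥-elim (T⇒¬T-not t nt)
          to (move mine _ , _) = ⊥-elim (≢opp σ (trans (sym mine) theirs))
          to (all _ _ a , r)   = a , r
          from∘to : ∀ s → (all theirs nt (proj₁ (to s)) , proj₂ (to s)) ≡ s
          from∘to (leaf t , _)      = ⊥-elim (T⇒¬T-not t nt)
          from∘to (move mine _ , _) = ⊥-elim (≢opp σ (trans (sym mine) theirs))
          from∘to (all theirs′ nt′ a , r)
            with refl ← uip theirs theirs′ | refl ← T-irrelevant nt nt′ = refl

      module _ {A : Set} {_⊕_ _⊗_ : A → A → A} {𝟘 𝟙 : A} (I : TypeInterpretation _⊕_ _⊗_ 𝟘 𝟙)
               (leaf : Fin n → A) (⟦leaf⟧ : ∀ t → TypeInterpretation.⟦_⟧ I (leaf t) ↔ t ∈ W) where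
        open TypeInterpretation I
        open EquationalReasoning

        private
          val : ℕ → Fin n → A
          val = valuationFuel G _⊕_ _⊗_ 𝟘 𝟙 leaf σ

        mutual
          valuationFuel↔reachingStrategy : ∀ k v → DepthBelow k v → ⟦ val k v ⟧ ↔ ReachingStrategy v
          valuationFuel↔reachingStrategy (suc k) v below with positionView v
          ... | terminal t = begin
            ⟦ val (suc k) v ⟧   ≡⟨ cong ⟦_⟧ (valuationFuel-terminal _⊕_ _⊗_ 𝟘 𝟙 leaf k t) ⟩
            ⟦ leaf v ⟧          ↔⟨ ⟦leaf⟧ v ⟩
            v ∈ W               ↔⟨ reachingStrategy-terminal t ⟨
            ReachingStrategy v  ∎
          ... | own mine nt = begin
            ⟦ val (suc k) v ⟧                       ≡⟨ cong ⟦_⟧ (valuationFuel-own _⊕_ _⊗_ 𝟘 𝟙 leaf k mine nt) ⟩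
            ⟦ foldr _⊕_ 𝟘 (map (val k) (succ v)) ⟧  ↔⟨ sum↔reachingChoice k (succ v) below ⟩
            ReachingChoice (succ v)                 ↔⟨ reachingStrategy-own mine nt ⟨
            ReachingStrategy v                      ∎
          ... | opponent theirs nt = begin
            ⟦ val (suc k) v ⟧                       ≡⟨ cong ⟦_⟧ (valuationFuel-opponent _⊕_ _⊗_ 𝟘 𝟙 leaf k theirs nt) ⟩
            ⟦ foldr _⊗_ 𝟙 (map (val k) (succ v)) ⟧  ↔⟨ product↔reachingAll k (succ v) below ⟩
            ReachingAll (succ v)                    ↔⟨ reachingStrategy-opponent theirs nt ⟨
            ReachingStrategy v                      ∎

          sum↔reachingChoice : ∀ k ws → All (DepthBelow k) ws →
                               ⟦ foldr _⊕_ 𝟘 (map (val k) ws) ⟧ ↔ ReachingChoice ws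
          sum↔reachingChoice k [] [] = ↔-trans ⟦𝟘⟧ (↔-sym reachingChoice-[])
          sum↔reachingChoice k (w ∷ ws) (below ∷ belows) = begin
            ⟦ val k w ⊕ foldr _⊕_ 𝟘 (map (val k) ws) ⟧        ↔⟨ ⟦⊕⟧ _ _ ⟩
            (⟦ val k w ⟧ ⊎ ⟦ foldr _⊕_ 𝟘 (map (val k) ws) ⟧)  ↔⟨ (valuationFuel↔reachingStrategy k w below
                                                                  ⊎-cong sum↔reachingChoice k ws belows) ⟩
            (ReachingStrategy w ⊎ ReachingChoice ws)          ↔⟨ reachingChoice-∷ ⟨
            ReachingChoice (w ∷ ws)                           ∎

          product↔reachingAll : ∀ k ws → All (DepthBelow k) ws →
                                ⟦ foldr _⊗_ 𝟙 (map (val k) ws) ⟧ ↔ ReachingAll ws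
          product↔reachingAll k [] [] = ↔-trans ⟦𝟙⟧ (↔-sym reachingAll-[])
          product↔reachingAll k (w ∷ ws) (below ∷ belows) = begin
            ⟦ val k w ⊗ foldr _⊗_ 𝟙 (map (val k) ws) ⟧        ↔⟨ ⟦⊗⟧ _ _ ⟩
            (⟦ val k w ⟧ × ⟦ foldr _⊗_ 𝟙 (map (val k) ws) ⟧)  ↔⟨ (valuationFuel↔reachingStrategy k w below
                                                                  ×-cong product↔reachingAll k ws belows) ⟩
            (ReachingStrategy w × ReachingAll ws)             ↔⟨ reachingAll-∷ ⟨
            ReachingAll (w ∷ ws)                              ∎

        valuation↔reachingStrategy : Acyclic G → ∀ v →
                                     ⟦ valuation G _⊕_ _⊗_ 𝟘 𝟙 leaf σ v ⟧ ↔ ReachingStrategy v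
        valuation↔reachingStrategy acyclic v =
          valuationFuel↔reachingStrategy n v (acyclic⇒depthBelow acyclic v)

T-lookup↔∈ : ∀ {n} (W : Subset n) t → T (lookup W t) ↔ t ∈ W
T-lookup↔∈ W t = ↔-trans T↔≡true (↔-sym []=↔lookup)

Fin-if↔T : ∀ b → Fin (if b then 1 else 0) ↔ T b
Fin-if↔T true  = 1↔⊤
Fin-if↔T false = 0↔⊥

Fin-interpretation : TypeInterpretation _+_ _*_ 0 1
Fin-interpretation = record
  { ⟦_⟧ = Fin ; ⟦⊕⟧ = λ _ _ → +↔⊎ ; ⟦⊗⟧ = λ _ _ → *↔× ; ⟦𝟘⟧ = 0↔⊥ ; ⟦𝟙⟧ = 1↔⊤ }

-- Monomials over W

allowed : Bool → ℕ → Bool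
allowed b e = if b then true else (e ≡ᵇ 0)

-- onlyIn G W does not depend on G; this copy of it admits induction on the number of positions.
onlyIn′ : ∀ {k} → Subset k → Monomial k → Bool
onlyIn′ W m = Vec.foldr (λ _ → Bool) _∧_ true (zipWith allowed W m)

onlyIn′-mon1 : ∀ {k} (W : Subset k) → onlyIn′ W mon1 ≡ true
onlyIn′-mon1 []      = refl
onlyIn′-mon1 (b ∷ W) rewrite onlyIn′-mon1 W with b
... | true  = refl
... | false = refl

onlyIn′-var : ∀ {k} (W : Subset k) t → onlyIn′ W (var t) ≡ lookup W t
onlyIn′-var (b ∷ W) zero    rewrite onlyIn′-mon1 W with b
... | true  = refl
... | false = refl
onlyIn′-var (b ∷ W) (suc t) rewrite onlyIn′-var W t with b
... | true  = refl
... | false = refl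

allowed-+ : ∀ b x y → allowed b (x + y) ≡ allowed b x ∧ allowed b y
allowed-+ true  x       y = refl
allowed-+ false zero    y = refl
allowed-+ false (suc x) y = refl

onlyIn′-·ₘ : ∀ {k} (W : Subset k) m m′ → onlyIn′ W (m ·ₘ m′) ≡ onlyIn′ W m ∧ onlyIn′ W m′
onlyIn′-·ₘ []      []      []        = refl
onlyIn′-·ₘ (b ∷ W) (x ∷ m) (y ∷ m′) rewrite allowed-+ b x y | onlyIn′-·ₘ W m m′ =
  interchange (allowed b x) (allowed b y) (onlyIn′ W m) (onlyIn′ W m′)

onlyIn′-dropExp : ∀ {k} (W : Subset k) m → onlyIn′ W (dropExp m) ≡ onlyIn′ W m
onlyIn′-dropExp []      []      = refl
onlyIn′-dropExp (b ∷ W) (x ∷ m) rewrite onlyIn′-dropExp W m with b | x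
... | true  | _     = refl
... | false | zero  = refl
... | false | suc _ = refl

allowed-antitone : ∀ b {x y} → x ≤ y → T (allowed b y) → T (allowed b x)
allowed-antitone true  _   _ = tt
allowed-antitone false z≤n _ = tt

onlyIn′-antitone : ∀ {k} (W : Subset k) {m m′} → T (m ≤ₘ m′) → T (onlyIn′ W m′) → T (onlyIn′ W m)
onlyIn′-antitone []      {[]}    {[]}      _  _ = tt
onlyIn′-antitone (b ∷ W) {x ∷ m} {y ∷ m′} le ok =
  let x≤y , m≤m′ = Equivalence.to T-∧ le
      okˣ , okᵐ  = Equivalence.to T-∧ ok
  in Equivalence.from T-∧ (allowed-antitone b (≤ᵇ⇒≤ x y x≤y) okˣ , onlyIn′-antitone W m≤m′ okᵐ)

module _ {n : ℕ} (W : Subset n) where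

  MonomialsOver : Poly n → Set
  MonomialsOver = Any (T ∘ onlyIn′ W)

  monomialsOver-++ : ∀ p q → MonomialsOver (p +ₚ q) ↔ (MonomialsOver p ⊎ MonomialsOver q)
  monomialsOver-++ p q = ↔-sym ++↔

  monomialsOver-·ₚ : ∀ p q → MonomialsOver (p ·ₚ q) ↔ (MonomialsOver p × MonomialsOver q)
  monomialsOver-·ₚ p q = begin
    Any Over (concatMap (λ m → map (m ·ₘ_) q) p)    ↔⟨ concat↔ ⟨
    Any (Any Over) (map (λ m → map (m ·ₘ_) q) p)    ↔⟨ map↔ ⟨
    Any (λ m → Any Over (map (m ·ₘ_) q)) p          ↔⟨ Any-cong {k = bijection} (λ _ → ↔-sym map↔) ↔-refl ⟩
    Any (λ m → Any (λ m′ → Over (m ·ₘ m′)) q) p     ↔⟨ Any-cong {k = bijection}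
                                                         (λ m → Any-cong {k = bijection} (λ m′ → over-·ₘ m m′) ↔-refl) ↔-refl ⟩
    Any (λ m → Any (λ m′ → Over m × Over m′) q) p   ↔⟨ ×↔ ⟨
    (MonomialsOver p × MonomialsOver q)             ∎
    where
      open EquationalReasoning
      Over = T ∘ onlyIn′ W
      over-·ₘ : ∀ m m′ → Over (m ·ₘ m′) ↔ (Over m × Over m′)
      over-·ₘ m m′ = ↔-trans (≡⇒ (cong T (onlyIn′-·ₘ W m m′))) T-∧↔

  monomialsOver-interpretation : TypeInterpretation _+ₚ_ _·ₚ_ 0ₚ 1ₚ
  monomialsOver-interpretation = record
    { ⟦_⟧ = MonomialsOver
    ; ⟦⊕⟧ = monomialsOver-++
    ; ⟦⊗⟧ = monomialsOver-·ₚ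
    ; ⟦𝟘⟧ = ↔-sym ⊥↔Any[]
    ; ⟦𝟙⟧ = ↔-trans (↔-sym pure↔) (≡⇒ (cong T (onlyIn′-mon1 W)))
    }

  monomialsOver-var : ∀ t → MonomialsOver (var t ∷ []) ↔ t ∈ W
  monomialsOver-var t =
    ↔-trans (↔-sym pure↔) (↔-trans (≡⇒ (cong T (onlyIn′-var W t))) (T-lookup↔∈ W t))

-- Normal forms in the provenance semirings

degree : ∀ {k} → Monomial k → ℕ
degree = Vec.sum

≤ₘ⇒degree≤ : ∀ {k} {m m′ : Monomial k} → T (m ≤ₘ m′) → degree m ≤ degree m′
≤ₘ⇒degree≤ {m = []}    {[]}      _  = z≤n
≤ₘ⇒degree≤ {m = x ∷ m} {y ∷ m′} le =
  let x≤y , m≤m′ = Equivalence.to T-∧ le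
  in +-mono-≤ (≤ᵇ⇒≤ x y x≤y) (≤ₘ⇒degree≤ {m = m} {m′} m≤m′)

<ₘ-∷ : ∀ {k} {x y} {m m′ : Monomial k} → T ((x ∷ m) <ₘ (y ∷ m′)) →
       (x < y × T (m ≤ₘ m′)) ⊎ (x ≡ y × T (m <ₘ m′))
<ₘ-∷ {x = x} {y} lt with Equivalence.to T-∧ lt
... | le , ne with Equivalence.to T-∧ le | x ≟ y
...   | x≤y , m≤m′ | no x≢y   = inj₁ (≤∧≢⇒< (≤ᵇ⇒≤ x y x≤y) x≢y , m≤m′)
...   | x≤y , m≤m′ | yes refl = inj₂ (refl , Equivalence.from T-∧ (m≤m′ , not-∧ʳ (≡⇒≡ᵇ x x refl) ne))
  where
    not-∧ʳ : ∀ {b c} → T b → T (not (b ∧ c)) → T (not c)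
    not-∧ʳ {true} _ nc = nc

<ₘ⇒degree< : ∀ {k} {m m′ : Monomial k} → T (m <ₘ m′) → degree m < degree m′
<ₘ⇒degree< {m = []}    {[]}      ()
<ₘ⇒degree< {m = x ∷ m} {y ∷ m′} lt with <ₘ-∷ {x = x} {y} {m} {m′} lt
... | inj₁ (x<y , m≤m′) = +-mono-<-≤ x<y (≤ₘ⇒degree≤ {m = m} {m′} m≤m′)
... | inj₂ (refl , m<m′) = +-monoʳ-< x (<ₘ⇒degree< {m = m} {m′} m<m′)

<ₘ-wellFounded : ∀ {k} → WellFounded (λ (m m′ : Monomial k) → T (m <ₘ m′))
<ₘ-wellFounded = Subrelation.wellFounded (λ {m} {m′} → <ₘ⇒degree< {m = m} {m′})
                                         (On.wellFounded degree <-wellFounded)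

module _ {k} {P : Monomial k → Set} (P-antitone : ∀ {m m′} → T (m ≤ₘ m′) → P m′ → P m) where

  Any-minimal⁺ : ∀ p → Any P p → Any P (minimal p)
  Any-minimal⁺ p a =
    let m , m∈p , Pm = find a
    in deduplicate⁺ (≡-dec _≟_) (λ { refl Px → Px }) (minimalBelow (<ₘ-wellFounded m) m∈p Pm)
    where
      IsMinimal : Monomial k → Bool
      IsMinimal m = not (any (λ m′ → m′ <ₘ m) p)

      minimalBelow : ∀ {m} → Acc (λ m m′ → T (m <ₘ m′)) m → m ∈ₗ p → P m → Any P (filterᵇ IsMinimal p)
      minimalBelow {m} (acc smaller) m∈p Pm with T? (any (λ m′ → m′ <ₘ m) p)
      ... | yes below = let m′ , m′∈p , m′<m = find (any⁻ _ p below)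
                        in minimalBelow (smaller m′<m) m′∈p (P-antitone (proj₁ (Equivalence.to T-∧ m′<m)) Pm)
      ... | no ¬below = lose (∈-filter⁺ (T? ∘ IsMinimal) m∈p (¬T⇒T-not ¬below)) Pm

  Any-minimal⇔ : ∀ p → Any P (minimal p) ⇔ Any P p
  Any-minimal⇔ p = mk⇔ (filter⁻ _ ∘ deduplicate⁻ (≡-dec _≟_)) (Any-minimal⁺ p)

Any-dedup⇔ : ∀ {k} {P : Monomial k → Set} p → Any P (dedup p) ⇔ Any P p
Any-dedup⇔ p = mk⇔ (deduplicate⁻ (≡-dec _≟_)) (deduplicate⁺ (≡-dec _≟_) (λ { refl Px → Px }))

Any-dropExp⇔ : ∀ {k} {P : Monomial k → Set} → (∀ m → P (dropExp m) ⇔ P m) →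
               ∀ p → Any P (map dropExp p) ⇔ Any P p
Any-dropExp⇔ P-dropExp p =
  mk⇔ (Any.map (Equivalence.to (P-dropExp _)) ∘ map⁻) (map⁺ ∘ Any.map (Equivalence.from (P-dropExp _)))

Any-normal⇔ : ∀ {k} {P : Monomial k → Set} →
              (∀ {m m′} → T (m ≤ₘ m′) → P m′ → P m) → (∀ m → P (dropExp m) ⇔ P m) →
              ∀ S p → Any P (normal S p) ⇔ Any P p
Any-normal⇔ _          _         ℕ[T]       p = ⇔-refl
Any-normal⇔ _          _         𝔹[T]       p = Any-dedup⇔ p
Any-normal⇔ _          P-dropExp 𝕎[T]       p = ⇔-trans (Any-dedup⇔ (map dropExp p)) (Any-dropExp⇔ P-dropExp p)
Any-normal⇔ P-antitone _         𝕊[T]       p = Any-minimal⇔ P-antitone p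
Any-normal⇔ P-antitone P-dropExp PosBool[T] p =
  ⇔-trans (Any-minimal⇔ P-antitone (map dropExp p)) (Any-dropExp⇔ P-dropExp p)

module _ {n : ℕ} (G : GameGraph n) (W : Subset n) where

  monomialsOver-normal⇔ : ∀ S p → MonomialsOver W (normal S p) ⇔ MonomialsOver W p
  monomialsOver-normal⇔ = Any-normal⇔ (onlyIn′-antitone W) (λ m → ≡⇒ (cong T (onlyIn′-dropExp W m)))

  W-part-nonzero⇔monomialsOver : ∀ S p →
    (¬ (filterᵇ (onlyIn G W) (normal S p) ≈[ S ] 0ₚ)) ⇔ MonomialsOver W p
  W-part-nonzero⇔monomialsOver S p = mk⇔ nonzero⇒ ⇒nonzero
    where
      Over? = T? ∘ onlyIn G W
      W-part = filterᵇ (onlyIn G W) (normal S p)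

      nonzero⇒ : ¬ (W-part ≈[ S ] 0ₚ) → MonomialsOver W p
      nonzero⇒ nonzero with any? Over? (normal S p)
      ... | yes some = Equivalence.to (monomialsOver-normal⇔ S p) some
      ... | no none  = contradiction (↭-reflexive (cong (normal S) (filter-none Over? (¬Any⇒All¬ _ none)))) nonzero

      ⇒nonzero : MonomialsOver W p → ¬ (W-part ≈[ S ] 0ₚ)
      ⇒nonzero some W-part≈0 =
        let inNormal = Equivalence.to (⇔-sym (monomialsOver-normal⇔ S p)) some
            m , m∈ , over = find inNormal
            inPart = lose (∈-filter⁺ Over? m∈ over) over
            inZero = Any-resp-↭ W-part≈0 (Equivalence.from (monomialsOver-normal⇔ S W-part) inPart)
        in ¬Any[] (Equivalence.to (monomialsOver-normal⇔ S []) inZero)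

mainTheorem3 : ∀ {n} (G : GameGraph n) → Acyclic G →
    (σ : Player) (W : Subset n) → (∀ t → t ∈ W → Terminal G t) →
    (v : Fin n) →
    ((P : ProvSemiring) →
       Σ (Strategy G σ v) (Reaches G W) ⇔ (¬ (fW G P σ W v ≈[ P ] 0ₚ)))
    × (Fin (countVal G σ W v) ↔ Σ (Strategy G σ v) (Reaches G W))
mainTheorem3 G acyclic σ W _ v = semirings , counting
  where
    monomials↔ : MonomialsOver W (fval G σ v) ↔ ReachingStrategy G σ W v
    monomials↔ = valuation↔reachingStrategy G σ W (monomialsOver-interpretation W)
                   (λ t → var t ∷ []) (monomialsOver-var W) acyclic v

    semirings : ∀ P → ReachingStrategy G σ W v ⇔ (¬ (fW G P σ W v ≈[ P ] 0ₚ))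
    semirings P = ⇔-trans (↔⇒⇔ (↔-sym monomials↔)) (⇔-sym (W-part-nonzero⇔monomialsOver G W P (fval G σ v)))

    counting : Fin (countVal G σ W v) ↔ ReachingStrategy G σ W v
    counting = valuation↔reachingStrategy G σ W Fin-interpretation
                 (λ t → if lookup W t then 1 else 0) (λ t → ↔-trans (Fin-if↔T (lookup W t)) (T-lookup↔∈ W t))
                 acyclic v
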